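{- For every $n\geq 1$: (a) $\phi(1p_{2n+2}1)0 = 0p_{2n+3}0$; (b) $0^{ -1}\phi(0p_{2n+1}0) = 1p_{2n+2}1$; (c) $\phi(M_{2n+1})0 = M_{2n+2}$; (d) $0^{ -1}\phi(M_{2n+2}) = M_{2n+3}$.
   Context: Let $\phi$ be the morphism on $\{0,1\}^*$ with $\phi(0)=01$, $\phi(1)=0$. Finite Fibonacci words: $f_1=1$, $f_2=0$, $f_{n+2}=f_{n+1}f_n$. For $n\geq 3$, $p_n$ is $f_n$ with its last two letters deleted ($p_3=\epsilon$, $p_4=0$, $p_5=010$, ...). The minimal forbidden factors of the infinite Fibonacci word are $M_{2n+1}=1p_{2n+1}1$ and $M_{2n+2}=0p_{2n+2}0$ for $n\geq 1$. For a word $w$ beginning with $0$, $0^{ -1}w$ denotes $w$ with its first letter removed. -}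

module Defs where

open import Data.Nat using (ℕ; zero; suc; _+_; _*_; _∸_)
open import Data.List using (List; []; _∷_; _++_; concatMap; take; length)

data Bit : Set where
  𝟎 𝟏 : Bit

Word : Set
Word = List Bit

φ₁ : Bit → Word
φ₁ 𝟎 = 𝟎 ∷ 𝟏 ∷ []
φ₁ 𝟏 = 𝟎 ∷ []

φ : Word → Word
φ = concatMap φ₁

-- finite Fibonacci words: fib n = f_{n+1}, i.e. f₁ = 1, f₂ = 0, f_{n+2} = f_{n+1} f_n
fib : ℕ → Word
fib zero = 𝟏 ∷ []
fib (suc zero) = 𝟎 ∷ []
fib (suc (suc n)) = fib (suc n) ++ fib n

-- f n = f_n for n ≥ 1 (f 0 is an unused junk value)
f : ℕ → Word
f zero = []
f (suc n) = fib n

-- p_n = f_n with its last two letters deleted (used for n ≥ 3)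
p : ℕ → Word
p n = take (length (f n) ∸ 2) (f n)

-- minimal forbidden factors (for n ≥ 1):
-- Modd n = M_{2n+1} = 1 p_{2n+1} 1,  Meven n = M_{2n+2} = 0 p_{2n+2} 0
Modd : ℕ → Word
Modd n = 𝟏 ∷ p (2 * n + 1) ++ 𝟏 ∷ []

Meven : ℕ → Word
Meven n = 𝟎 ∷ p (2 * n + 2) ++ 𝟎 ∷ []

-- Since φ(f_k) = f_{k+1} and the last two letters of f_k alternate between
-- 01 and 10, the words central j = p_{j+3} satisfy the recursion ε, φ(·)0. Both
-- identities then follow for every a ≥ 3 by expanding φ(x p_a x) letter by
-- letter; the parity in the theorem only decides which one names M_{a+1}.
module Submission where

open import Defs
open import Data.Nat using (ℕ; suc; _≥_; _≤_; _+_; _*_; _∸_; s≤s; z≤n)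
open import Data.Nat.Properties using (m+n∸n≡m; +-suc; +-assoc; *-distribˡ-+; +-mono-≤; *-monoʳ-≤)
open import Data.List using (List; []; _∷_; _++_; take; length)
open import Data.List.Properties using (++-assoc; length-++; concatMap-++)
open import Data.Product using (_×_; _,_; ∃-syntax)
open import Relation.Binary.PropositionalEquality
open ≡-Reasoning

φ-++ : ∀ (u v : Word) → φ (u ++ v) ≡ φ u ++ φ v
φ-++ = concatMap-++ φ₁

φ-fib : ∀ k → φ (fib k) ≡ fib (suc k)
φ-fib 0 = refl
φ-fib 1 = refl
φ-fib (suc (suc k)) = begin
  φ (fib (suc k) ++ fib k)        ≡⟨ φ-++ (fib (suc k)) (fib k) ⟩
  φ (fib (suc k)) ++ φ (fib k)    ≡⟨ cong₂ _++_ (φ-fib (suc k)) (φ-fib k) ⟩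
  fib (suc (suc (suc k))) ∎

complement : Bit → Bit
complement 𝟎 = 𝟏
complement 𝟏 = 𝟎

φ-++-alternating : ∀ (w : Word) b →
  φ (w ++ b ∷ complement b ∷ []) ≡ (φ w ++ 𝟎 ∷ []) ++ complement b ∷ b ∷ []
φ-++-alternating w 𝟎 = trans (φ-++ w (𝟎 ∷ 𝟏 ∷ [])) (sym (++-assoc (φ w) (𝟎 ∷ []) _))
φ-++-alternating w 𝟏 = trans (φ-++ w (𝟏 ∷ 𝟎 ∷ [])) (sym (++-assoc (φ w) (𝟎 ∷ []) _))

central : ℕ → Word
central 0 = []
central (suc j) = φ (central j) ++ 𝟎 ∷ []

fib-central : ∀ j → ∃[ b ] fib (suc (suc j)) ≡ central j ++ b ∷ complement b ∷ []
fib-central 0 = 𝟎 , refl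
fib-central (suc j) with fib-central j
... | b , eq = complement b , (begin
  fib (suc (suc (suc j)))                           ≡⟨ sym (φ-fib (suc (suc j))) ⟩
  φ (fib (suc (suc j)))                             ≡⟨ cong φ eq ⟩
  φ (central j ++ b ∷ complement b ∷ [])            ≡⟨ φ-++-alternating (central j) b ⟩
  central (suc j) ++ complement b ∷ b ∷ []
    ≡⟨ cong (λ c → central (suc j) ++ complement b ∷ c ∷ []) (complement-involutive b) ⟨
  central (suc j) ++ complement b ∷ complement (complement b) ∷ [] ∎)
  where
  complement-involutive : ∀ c → complement (complement c) ≡ c
  complement-involutive 𝟎 = refl
  complement-involutive 𝟏 = refl

take-length-++ : ∀ {A : Set} (xs ys : List A) → take (length xs) (xs ++ ys) ≡ xs
take-length-++ [] ys = refl
take-length-++ (x ∷ xs) ys = cong (x ∷_) (take-length-++ xs ys)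

take-dropping-last-two : ∀ {A : Set} (xs : List A) x y →
  take (length (xs ++ x ∷ y ∷ []) ∸ 2) (xs ++ x ∷ y ∷ []) ≡ xs
take-dropping-last-two xs x y = begin
  take (length (xs ++ x ∷ y ∷ []) ∸ 2) (xs ++ x ∷ y ∷ [])
    ≡⟨ cong (λ l → take (l ∸ 2) (xs ++ x ∷ y ∷ [])) (length-++ xs) ⟩
  take (length xs + 2 ∸ 2) (xs ++ x ∷ y ∷ [])
    ≡⟨ cong (λ l → take l (xs ++ x ∷ y ∷ [])) (m+n∸n≡m (length xs) 2) ⟩
  take (length xs) (xs ++ x ∷ y ∷ [])
    ≡⟨ take-length-++ xs _ ⟩
  xs ∎

p-central : ∀ j → p (3 + j) ≡ central j
p-central j with fib-central j
... | b , eq = trans (cong (λ w → take (length w ∸ 2) w) eq)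
                     (take-dropping-last-two (central j) b (complement b))

φ-𝟏p𝟏 : ∀ {a b} → 3 ≤ a → suc a ≡ b →
  φ (𝟏 ∷ p a ++ 𝟏 ∷ []) ++ 𝟎 ∷ [] ≡ 𝟎 ∷ p b ++ 𝟎 ∷ []
φ-𝟏p𝟏 (s≤s (s≤s (s≤s {n = j} _))) refl
  rewrite p-central j | p-central (suc j) | φ-++ (central j) (𝟏 ∷ [])
  = refl

φ-𝟎p𝟎 : ∀ {a b} → 3 ≤ a → suc a ≡ b →
  φ (𝟎 ∷ p a ++ 𝟎 ∷ []) ≡ 𝟎 ∷ (𝟏 ∷ p b ++ 𝟏 ∷ [])
φ-𝟎p𝟎 (s≤s (s≤s (s≤s {n = j} _))) refl
  rewrite p-central j | p-central (suc j) | φ-++ (central j) (𝟎 ∷ [])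
  = cong (λ w → 𝟎 ∷ 𝟏 ∷ w) (sym (++-assoc (φ (central j)) (𝟎 ∷ []) (𝟏 ∷ [])))

lemma5 : (n : ℕ) → n ≥ 1 →
    (φ (𝟏 ∷ p (2 * n + 2) ++ 𝟏 ∷ []) ++ 𝟎 ∷ [] ≡ 𝟎 ∷ p (2 * n + 3) ++ 𝟎 ∷ [])
    × (φ (𝟎 ∷ p (2 * n + 1) ++ 𝟎 ∷ []) ≡ 𝟎 ∷ (𝟏 ∷ p (2 * n + 2) ++ 𝟏 ∷ []))
    × (φ (Modd n) ++ 𝟎 ∷ [] ≡ Meven n)
    × (φ (Meven n) ≡ 𝟎 ∷ Modd (n + 1))
lemma5 n n≥1 =
    φ-𝟏p𝟏 3≤2n+2 (sym (+-suc (2 * n) 2))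
  , φ-𝟎p𝟎 3≤2n+1 (sym (+-suc (2 * n) 1))
  , φ-𝟏p𝟏 3≤2n+1 (sym (+-suc (2 * n) 1))
  , φ-𝟎p𝟎 3≤2n+2 2n+3≡2[n+1]+1
  where
  3≤2n+1 : 3 ≤ 2 * n + 1
  3≤2n+1 = +-mono-≤ (*-monoʳ-≤ 2 n≥1) (s≤s z≤n)
  3≤2n+2 : 3 ≤ 2 * n + 2
  3≤2n+2 = +-mono-≤ (*-monoʳ-≤ 2 n≥1) (s≤s z≤n)
  2n+3≡2[n+1]+1 : suc (2 * n + 2) ≡ 2 * (n + 1) + 1
  2n+3≡2[n+1]+1 = begin
    suc (2 * n + 2)      ≡⟨ +-suc (2 * n) 2 ⟨
    2 * n + 3            ≡⟨ +-assoc (2 * n) 2 1 ⟨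
    2 * n + 2 + 1        ≡⟨ cong (_+ 1) (*-distribˡ-+ 2 n 1) ⟨
    2 * (n + 1) + 1      ∎
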